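{- Let $k\geq3$ and $n\geq 3$. Suppose $[a_0,a_1,\dots,a_{n-1}]$ is a negasymmetric circuit in $\mathcal{C}_k(n-1)$ of period $c$, where $c$ is odd (and $c\mid n$). Then $(a_{\overline{s}},a_{\overline{s+1}},\dots,a_{\overline{s-1}})$ is a negasymmetric $n$-tuple for some $s$ with $0\leq s\leq n-1$, where $\overline{x}=x\bmod n$. Moreover, $[a_0,a_1,\dots,a_{n-1}]$ contains precisely one negasymmetric $n$-tuple.
   Context: Tuples are $k$-ary (entries in $\mathbb{Z}_k$), negation is modulo $k$, $\mathbf{u}^R$ is the reverse of $\mathbf{u}$; a tuple $\mathbf{u}$ is negasymmetric if $\mathbf{u}=-\mathbf{u}^R$. The pseudoweight of $a\in\mathbb{Z}_k$ is $a$ if $a\ne0$ and $k/2$ if $a=0$, and of a tuple the sum over its entries. $B_k(n-1)$ is the de Bruijn digraph with vertices the $k$-ary $(n-1)$-tuples and edges the $k$-ary $n$-tuples $(a_0,\dots,a_{n-1})$ from $(a_0,\dots,a_{n-2})$ to $(a_1,\dots,a_{n-1})$; $H_k(n-1)$ is its subgraph of edges of pseudoweight exactly $kn/2$. For an $n$-tuple $(a_0,\dots,a_{n-1})$, with $p$ the least positive $d$ such that $a_i=a_{(i+d)\bmod n}$ for all $i$, $[a_0,\dots,a_{n-1}]$ is the circuit whose edges (the $n$-tuples it contains) are the $p$ cyclic shifts $(a_j,\dots,a_{j+n-1})$ (indices mod $n$), $0\le j<p$; $p$ is its period. $\mathcal{C}_k(n-1)$ is the set of such circuits arising from edges of $H_k(n-1)$.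 A circuit is negasymmetric if it contains edges $\mathbf a,\mathbf b$ (not necessarily distinct) with $\mathbf a=-\mathbf b^R$. -}

module Defs where

open import Data.Nat using (ℕ; zero; suc; _+_; _*_; _∸_; _<_; NonZero)
open import Data.Nat.DivMod using (_mod_)
open import Data.Fin using (Fin; toℕ; opposite)
import Data.Fin as F
open import Data.List using (map; allFin)
open import Data.Nat.ListAction using (sum)
open import Data.Product using (Σ; _×_; ∃-syntax)
open import Relation.Binary.PropositionalEquality using (_≡_)
open import Relation.Nullary using (¬_)

-- A k-ary n-tuple: entries in ℤ_k (represented by Fin k), positions 0..n-1.
Tuple : ℕ → ℕ → Set
Tuple k n = Fin n → Fin k

negₖ : ∀ {k} → Fin k → Fin k
negₖ {suc k} a = (suc k ∸ toℕ a) mod (suc k)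

negT : ∀ {k n} → Tuple k n → Tuple k n
negT u i = negₖ (u i)

rev : ∀ {k n} → Tuple k n → Tuple k n
rev u i = u (opposite i)

_≗ᵗ_ : ∀ {k n} → Tuple k n → Tuple k n → Set
u ≗ᵗ v = ∀ i → u i ≡ v i

Negasymmetric : ∀ {k n} → Tuple k n → Set
Negasymmetric u = u ≗ᵗ negT (rev u)

-- twice the pseudoweight of an entry: 2a if a ≠ 0, k if a = 0
pw2 : ∀ {k} → Fin k → ℕ
pw2 {k} F.zero    = k
pw2 {k} (F.suc a) = 2 * suc (toℕ a)

pw2T : ∀ {k n} → Tuple k n → ℕ
pw2T {k} {n} u = sum (map (λ i → pw2 (u i)) (allFin n))

-- edge of H_k(n-1): pseudoweight exactly kn/2, i.e. twice the pseudoweight is k*n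
IsHEdge : ∀ {k n} → Tuple k n → Set
IsHEdge {k} {n} u = pw2T u ≡ k * n

at : ∀ {k n} .{{_ : NonZero n}} → Tuple k n → ℕ → Fin k
at {n = n} u x = u (x mod n)

shift : ∀ {k n} .{{_ : NonZero n}} → Tuple k n → ℕ → Tuple k n
shift u j i = at u (toℕ i + j)

IsShiftInvariant : ∀ {k n} .{{_ : NonZero n}} → Tuple k n → ℕ → Set
IsShiftInvariant u d = shift u d ≗ᵗ u

IsPeriod : ∀ {k n} .{{_ : NonZero n}} → Tuple k n → ℕ → Set
IsPeriod u p = (0 < p) × IsShiftInvariant u p
             × (∀ d → 0 < d → d < p → ¬ IsShiftInvariant u d)

InCircuit : ∀ {k n} .{{_ : NonZero n}} → Tuple k n → ℕ → Tuple k n → Set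
InCircuit a p b = ∃[ j ] (j < p × b ≗ᵗ shift a j)

-- the circuit [a] (of period p) is negasymmetric: it contains edges b, b'
-- (not necessarily distinct) with b = -(b')^R
NegasymmetricCircuit : ∀ {k n} .{{_ : NonZero n}} → Tuple k n → ℕ → Set
NegasymmetricCircuit a p =
  ∃[ b ] ∃[ b' ] (InCircuit a p b × InCircuit a p b' × b ≗ᵗ negT (rev b'))

{-# OPTIONS --safe #-}
module Submission where

open import Defs
open import Data.Nat using (ℕ; _≤_; _<_; NonZero)
open import Data.Nat.Divisibility using (_∣_)
open import Data.Product using (_×_; ∃-syntax)
open import Relation.Nullary using (¬_)

open import Data.Nat.Base using (zero; suc; _+_; _*_; _∸_; pred; _%_; _/_; s≤s)
open import Data.Nat.Properties
open import Data.Nat.DivMod using ([m+kn]%n≡m%n; m≡m%n+[m/n]*n; m%n<n; m<n⇒m%n≡m)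
open import Data.Nat.Divisibility using (divides; m%n≡0⇒n∣m; ∣⇒≤)
open import Data.Nat.Tactic.RingSolver using (solve)
open import Data.Fin using (Fin; toℕ; fromℕ<; opposite)
open import Data.Fin.Properties using (toℕ-injective; toℕ<n; toℕ-fromℕ<; opposite-prop)
open import Data.List.Base using (_∷_; [])
open import Data.Product using (_,_)
open import Relation.Binary.PropositionalEquality
open import Relation.Nullary using (yes; no; contradiction)
open import Function.Base using (_∘_)
open import Relation.Binary.Bundles using (Setoid)
import Relation.Binary.Reasoning.Setoid as SetoidReasoning
open import Algebra.Properties.CommutativeSemigroup +-commutativeSemigroup
  using () renaming (interchange to +-interchange)
open import Level using (0ℓ)

-- Read g x = a_(x mod n) as a c-periodic sequence.  A pair of edges b = -(b')ᴿ of the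
-- circuit makes g skew-symmetric about some M (g x = -g y whenever x + y ≡ M mod c), and the
-- shift by s is negasymmetric iff g is skew-symmetric about n - 1 + 2s.  Two centres of
-- skew-symmetry differ by a period of g, hence agree mod c; so the admissible s are the
-- solutions of 2s ≡ M - (n - 1) (mod c), which exist and are unique mod c as c is odd.

infix 4 _≡_mod_

-- A record rather than a Σ-type, so that x, y and m can be inferred from a proof.
record _≡_mod_ (x y m : ℕ) : Set where
  constructor congruent
  field
    p q : ℕ
    x+pm≡y+qm : x + p * m ≡ y + q * m

module _ {m : ℕ} where

  ≡⇒≡-mod : ∀ {x y} → x ≡ y → x ≡ y mod m
  ≡⇒≡-mod refl = congruent 0 0 refl

  ≡-mod-refl : ∀ {x} → x ≡ x mod m
  ≡-mod-refl = ≡⇒≡-mod refl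

  ≡-mod-sym : ∀ {x y} → x ≡ y mod m → y ≡ x mod m
  ≡-mod-sym (congruent p q e) = congruent q p (sym e)

  ≡-mod-trans : ∀ {x y z} → x ≡ y mod m → y ≡ z mod m → x ≡ z mod m
  ≡-mod-trans {x} {y} {z} (congruent p q e) (congruent r s e′) = congruent (p + r) (q + s) (begin
    x + (p + r) * m      ≡⟨ solve (x ∷ p ∷ r ∷ m ∷ []) ⟩
    (x + p * m) + r * m  ≡⟨ cong (_+ r * m) e ⟩
    (y + q * m) + r * m  ≡⟨ solve (y ∷ q ∷ r ∷ m ∷ []) ⟩
    (y + r * m) + q * m  ≡⟨ cong (_+ q * m) e′ ⟩
    (z + s * m) + q * m  ≡⟨ solve (z ∷ s ∷ q ∷ m ∷ []) ⟩
    z + (q + s) * m      ∎)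
    where open ≡-Reasoning

  ≡-mod-setoid : Setoid 0ℓ 0ℓ
  ≡-mod-setoid = record
    { Carrier       = ℕ
    ; _≈_           = λ x y → x ≡ y mod m
    ; isEquivalence = record { refl = ≡-mod-refl ; sym = ≡-mod-sym ; trans = ≡-mod-trans }
    }

  module ≡-mod-Reasoning = SetoidReasoning ≡-mod-setoid

  +-cong-mod : ∀ {x x′ y y′} → x ≡ x′ mod m → y ≡ y′ mod m → x + y ≡ x′ + y′ mod m
  +-cong-mod {x} {x′} {y} {y′} (congruent p q e) (congruent r s e′) =
    congruent (p + r) (q + s) (begin
    x + y + (p + r) * m          ≡⟨ solve (x ∷ y ∷ p ∷ r ∷ m ∷ []) ⟩
    (x + p * m) + (y + r * m)    ≡⟨ cong₂ _+_ e e′ ⟩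
    (x′ + q * m) + (y′ + s * m)  ≡⟨ solve (x′ ∷ y′ ∷ q ∷ s ∷ m ∷ []) ⟩
    x′ + y′ + (q + s) * m        ∎)
    where open ≡-Reasoning

  +-cancelˡ-mod : ∀ z {x y} → z + x ≡ z + y mod m → x ≡ y mod m
  +-cancelˡ-mod z {x} {y} (congruent p q e) = congruent p q (+-cancelˡ-≡ z _ _ (begin
    z + (x + p * m)  ≡⟨ +-assoc z x (p * m) ⟨
    z + x + p * m    ≡⟨ e ⟩
    z + y + q * m    ≡⟨ +-assoc z y (q * m) ⟩
    z + (y + q * m)  ∎))
    where open ≡-Reasoning

  *-congʳ-mod : ∀ z {x y} → x ≡ y mod m → x * z ≡ y * z mod m
  *-congʳ-mod z {x} {y} (congruent p q e) = congruent (p * z) (q * z) (begin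
    x * z + p * z * m  ≡⟨ solve (x ∷ z ∷ p ∷ m ∷ []) ⟩
    (x + p * m) * z    ≡⟨ cong (_* z) e ⟩
    (y + q * m) * z    ≡⟨ solve (y ∷ z ∷ q ∷ m ∷ []) ⟩
    y * z + q * z * m  ∎)
    where open ≡-Reasoning

  ∣⇒≡0-mod : ∀ {x} → m ∣ x → x ≡ 0 mod m
  ∣⇒≡0-mod (divides q refl) = congruent 0 q (+-identityʳ (q * m))

  ∣-≡-mod : ∀ {m′ x y} → m ∣ m′ → x ≡ y mod m′ → x ≡ y mod m
  ∣-≡-mod {x = x} {y} (divides r refl) (congruent p q e) = congruent (p * r) (q * r) (begin
    x + p * r * m    ≡⟨ cong (x +_) (*-assoc p r m) ⟩
    x + p * (r * m)  ≡⟨ e ⟩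
    y + q * (r * m)  ≡⟨ cong (y +_) (*-assoc q r m) ⟨
    y + q * r * m    ∎)
    where open ≡-Reasoning

  module _ .{{_ : NonZero m}} where

    %-≡-mod : ∀ x → x % m ≡ x mod m
    %-≡-mod x = congruent (x / m) 0 (trans (sym (m≡m%n+[m/n]*n x m)) (sym (+-identityʳ x)))

    ≡-mod⇒%≡ : ∀ {x y} → x ≡ y mod m → x % m ≡ y % m
    ≡-mod⇒%≡ {x} {y} (congruent p q e) = begin
      x % m            ≡⟨ [m+kn]%n≡m%n x p m ⟨
      (x + p * m) % m  ≡⟨ cong (_% m) e ⟩
      (y + q * m) % m  ≡⟨ [m+kn]%n≡m%n y q m ⟩
      y % m            ∎
      where open ≡-Reasoning

    <-≡-mod⇒≡ : ∀ {x y} → x < m → y < m → x ≡ y mod m → x ≡ y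
    <-≡-mod⇒≡ {x} {y} x<m y<m x≡y = begin
      x      ≡⟨ m<n⇒m%n≡m x<m ⟨
      x % m  ≡⟨ ≡-mod⇒%≡ x≡y ⟩
      y % m  ≡⟨ m<n⇒m%n≡m y<m ⟩
      y      ∎
      where open ≡-Reasoning

    -- y + x * pred m stands for y - x modulo m, avoiding truncated subtraction.
    +-inverse-mod : ∀ x y → x + (y + x * pred m) ≡ y mod m
    +-inverse-mod x y = congruent 0 x (begin
      x + (y + x * pred m) + 0  ≡⟨ rearrange (pred m) ⟩
      y + x * suc (pred m)      ≡⟨ cong (λ m′ → y + x * m′) (suc-pred m) ⟩
      y + x * m                 ∎)
      where
      open ≡-Reasoning
      rearrange : ∀ p → x + (y + x * p) + 0 ≡ y + x * suc p
      rearrange p = solve (x ∷ y ∷ p ∷ [])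

¬2∣n⇒n≡1+n/2*2 : ∀ {c} → ¬ 2 ∣ c → c ≡ suc (c / 2 * 2)
¬2∣n⇒n≡1+n/2*2 {c} 2∤c with c % 2 in c%2≡r | m%n<n c 2
... | 0           | _ = contradiction (m%n≡0⇒n∣m c 2 c%2≡r) 2∤c
... | 1           | _ = trans (m≡m%n+[m/n]*n c 2) (cong (_+ c / 2 * 2) c%2≡r)
... | suc (suc _) | s≤s (s≤s ())

module _ {c : ℕ} .{{_ : NonZero c}} (2∤c : ¬ 2 ∣ c) where

  [x+x]*suc[c/2]≡x : ∀ x → (x + x) * suc (c / 2) ≡ x mod c
  [x+x]*suc[c/2]≡x x = congruent 0 x (begin
    (x + x) * suc (c / 2) + 0  ≡⟨ rearrange (c / 2) ⟩
    x + x * suc (c / 2 * 2)    ≡⟨ cong (λ c′ → x + x * c′) (¬2∣n⇒n≡1+n/2*2 2∤c) ⟨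
    x + x * c                  ∎)
    where
    open ≡-Reasoning
    rearrange : ∀ h → (x + x) * suc h + 0 ≡ x + x * suc (h * 2)
    rearrange h = solve (x ∷ h ∷ [])

  halving-exists : ∀ m → ∃[ s ] (s < c × s + s ≡ m mod c)
  halving-exists m = s , m%n<n (m * suc (c / 2)) c , (begin
    s + s                                   ≈⟨ +-cong-mod (%-≡-mod _) (%-≡-mod _) ⟩
    m * suc (c / 2) + m * suc (c / 2)       ≈⟨ ≡⇒≡-mod (*-distribʳ-+ (suc (c / 2)) m m) ⟨
    (m + m) * suc (c / 2)                   ≈⟨ [x+x]*suc[c/2]≡x m ⟩
    m                                       ∎)
    where
    open ≡-mod-Reasoning
    s = m * suc (c / 2) % c

  halving-unique : ∀ {s t} → s < c → t < c → s + s ≡ t + t mod c → s ≡ t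
  halving-unique {s} {t} s<c t<c 2s≡2t = <-≡-mod⇒≡ s<c t<c (begin
    s                      ≈⟨ [x+x]*suc[c/2]≡x s ⟨
    (s + s) * suc (c / 2)  ≈⟨ *-congʳ-mod (suc (c / 2)) 2s≡2t ⟩
    (t + t) * suc (c / 2)  ≈⟨ [x+x]*suc[c/2]≡x t ⟩
    t                      ∎)
    where open ≡-mod-Reasoning

Periodic : {A : Set} → (ℕ → A) → ℕ → Set
Periodic g d = ∀ x → g (x + d) ≡ g x

module _ {A : Set} {g : ℕ → A} where

  periodic-+-multiple : ∀ {d} → Periodic g d → ∀ x q → g (x + q * d) ≡ g x
  periodic-+-multiple per x zero    = cong g (+-identityʳ x)
  periodic-+-multiple {d} per x (suc q) = begin
    g (x + (d + q * d))  ≡⟨ cong g (solve (x ∷ d ∷ q ∷ [])) ⟩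
    g (x + q * d + d)    ≡⟨ per (x + q * d) ⟩
    g (x + q * d)        ≡⟨ periodic-+-multiple per x q ⟩
    g x                  ∎
    where open ≡-Reasoning

  periodic-≡-mod : ∀ {d x y} → Periodic g d → x ≡ y mod d → g x ≡ g y
  periodic-≡-mod {d} {x} {y} per (congruent p q e) = begin
    g x            ≡⟨ periodic-+-multiple per x p ⟨
    g (x + p * d)  ≡⟨ cong g e ⟩
    g (y + q * d)  ≡⟨ periodic-+-multiple per y q ⟩
    g y            ∎
    where open ≡-Reasoning

  minimal-period-∣ : ∀ {c d} .{{_ : NonZero c}} → Periodic g c →
                     (∀ e → 0 < e → e < c → ¬ Periodic g e) → Periodic g d → c ∣ d
  minimal-period-∣ {c} {d} per-c minimal per-d with d % c ≟ 0
  ... | yes d%c≡0 = m%n≡0⇒n∣m d c d%c≡0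
  ... | no  d%c≢0 = contradiction per-d%c (minimal (d % c) (n≢0⇒n>0 d%c≢0) (m%n<n d c))
    where
    per-d%c : Periodic g (d % c)
    per-d%c x = trans (periodic-≡-mod per-c (+-cong-mod ≡-mod-refl (%-≡-mod d))) (per-d x)

-- With ν = negation mod k: g is negasymmetric about the centre M/2, indices read modulo c.
record SkewSymmetric {A : Set} (ν : A → A) (c : ℕ) (g : ℕ → A) (M : ℕ) : Set where
  constructor skewSymmetric
  field
    reflect : ∀ x y → x + y ≡ M mod c → g x ≡ ν (g y)

open SkewSymmetric

module _ {A : Set} {ν : A → A} {c : ℕ} {g : ℕ → A} where

  skewSymmetric-resp : ∀ {M M′} → M ≡ M′ mod c →
                       SkewSymmetric ν c g M → SkewSymmetric ν c g M′
  skewSymmetric-resp M≡M′ skew = skewSymmetric λ x y x+y≡M′ →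
    reflect skew x y (≡-mod-trans x+y≡M′ (≡-mod-sym M≡M′))

  module _ .{{_ : NonZero c}} where

    skewSymmetric-periodic : ∀ {M M′ D} → SkewSymmetric ν c g M → SkewSymmetric ν c g M′ →
                             M + D ≡ M′ mod c → Periodic g D
    skewSymmetric-periodic {M} {M′} {D} skew skew′ M+D≡M′ w =
      trans (reflect skew′ (w + D) y w+D+y≡M′) (sym (reflect skew w y (+-inverse-mod w M)))
      where
      y : ℕ
      y = M + w * pred c
      w+D+y≡M′ : w + D + y ≡ M′ mod c
      w+D+y≡M′ = begin
        w + D + y    ≡⟨ +-assoc w D y ⟩
        w + (D + y)  ≡⟨ cong (w +_) (+-comm D y) ⟩
        w + (y + D)  ≡⟨ +-assoc w y D ⟨
        w + y + D    ≈⟨ +-cong-mod (+-inverse-mod w M) ≡-mod-refl ⟩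
        M + D        ≈⟨ M+D≡M′ ⟩
        M′           ∎
        where open ≡-mod-Reasoning

    skewSymmetric-unique : ∀ {M M′} → Periodic g c → (∀ e → 0 < e → e < c → ¬ Periodic g e) →
                           SkewSymmetric ν c g M → SkewSymmetric ν c g M′ → M ≡ M′ mod c
    skewSymmetric-unique {M} {M′} per-c minimal skew skew′ = begin
      M      ≡⟨ +-identityʳ M ⟨
      M + 0  ≈⟨ +-cong-mod ≡-mod-refl D≡0 ⟨
      M + D  ≈⟨ M+D≡M′ ⟩
      M′     ∎
      where
      open ≡-mod-Reasoning
      D = M′ + M * pred c
      M+D≡M′ : M + D ≡ M′ mod c
      M+D≡M′ = +-inverse-mod M M′
      D≡0 : D ≡ 0 mod c
      D≡0 = ∣⇒≡0-mod (minimal-period-∣ per-c minimal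
                        (skewSymmetric-periodic skew skew′ M+D≡M′))

≗ᵗ-negT-rev-resp : ∀ {k n} {u u′ v v′ : Tuple k n} →
                   u ≗ᵗ u′ → v ≗ᵗ v′ → u ≗ᵗ negT (rev v) → u′ ≗ᵗ negT (rev v′)
≗ᵗ-negT-rev-resp u≗u′ v≗v′ u≗-vᴿ i =
  trans (sym (u≗u′ i)) (trans (u≗-vᴿ i) (cong negₖ (v≗v′ (opposite i))))

toℕ+toℕ-opposite : ∀ {n} (i : Fin n) → toℕ i + toℕ (opposite i) ≡ pred n
toℕ+toℕ-opposite {n} i = cong pred (begin
  suc (toℕ i + toℕ (opposite i))   ≡⟨ cong (suc (toℕ i) +_) (opposite-prop i) ⟩
  suc (toℕ i) + (n ∸ suc (toℕ i))  ≡⟨ m+[n∸m]≡n (toℕ<n i) ⟩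
  n                                ∎)
  where open ≡-Reasoning

toℕ+toℕ-opposite-shifted : ∀ {n} (i : Fin n) s t →
                           (toℕ i + s) + (toℕ (opposite i) + t) ≡ pred n + (s + t)
toℕ+toℕ-opposite-shifted i s t =
  trans (+-interchange (toℕ i) s (toℕ (opposite i)) t) (cong (_+ (s + t)) (toℕ+toℕ-opposite i))

toℕ-mod-≡-mod : ∀ {n} .{{_ : NonZero n}} x → toℕ (fromℕ< (m%n<n x n)) ≡ x mod n
toℕ-mod-≡-mod x = ≡-mod-trans (≡⇒≡-mod (toℕ-fromℕ< _)) (%-≡-mod x)

module _ {k n : ℕ} .{{_ : NonZero n}} (a : Tuple k n) where

  at-≡-mod : ∀ {x y} → x ≡ y mod n → at a x ≡ at a y
  at-≡-mod x≡y = cong a (toℕ-injective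
    (trans (toℕ-fromℕ< _) (trans (≡-mod⇒%≡ x≡y) (sym (toℕ-fromℕ< _)))))

  at-toℕ : ∀ i → at a (toℕ i) ≡ a i
  at-toℕ i = cong a (toℕ-injective (trans (toℕ-fromℕ< _) (m<n⇒m%n≡m (toℕ<n i))))

  at-periodic : Periodic (at a) n
  at-periodic x = at-≡-mod (congruent 0 1 (solve (x ∷ n ∷ [])))

  shiftInvariant⇒periodic : ∀ {d} → IsShiftInvariant a d → Periodic (at a) d
  shiftInvariant⇒periodic {d} invariant x =
    trans (at-≡-mod (+-cong-mod (≡-mod-sym (toℕ-mod-≡-mod x)) ≡-mod-refl))
          (invariant (fromℕ< (m%n<n x n)))

  periodic⇒shiftInvariant : ∀ {d} → Periodic (at a) d → IsShiftInvariant a d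
  periodic⇒shiftInvariant periodic i = trans (periodic (toℕ i)) (at-toℕ i)

  skewSymmetric⇒negasymmetric-shift : ∀ {c} s → SkewSymmetric negₖ c (at a) (pred n + (s + s)) →
                                      Negasymmetric (shift a s)
  skewSymmetric⇒negasymmetric-shift s skew i =
    reflect skew (toℕ i + s) (toℕ (opposite i) + s) (≡⇒≡-mod (toℕ+toℕ-opposite-shifted i s s))

  reflected-shifts⇒skewSymmetric : ∀ {c j j′} → c ∣ n → Periodic (at a) c →
                                   shift a j ≗ᵗ negT (rev (shift a j′)) →
                                   SkewSymmetric negₖ c (at a) (pred n + (j + j′))
  reflected-shifts⇒skewSymmetric {c} {j} {j′} c∣n periodic reflected = skewSymmetric reflection
    where
    reflection : ∀ x y → x + y ≡ pred n + (j + j′) mod c → at a x ≡ negₖ (at a y)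
    reflection x y x+y≡M =
      trans (sym (at-≡-mod i+j≡x))
            (trans (reflected i) (cong negₖ (periodic-≡-mod periodic i′+j′≡y)))
      where
      i : Fin n
      i = fromℕ< (m%n<n (x + j * pred n) n)
      i+j≡x : toℕ i + j ≡ x mod n
      i+j≡x = begin
        toℕ i + j             ≈⟨ +-cong-mod (toℕ-mod-≡-mod (x + j * pred n)) ≡-mod-refl ⟩
        x + j * pred n + j    ≡⟨ +-comm (x + j * pred n) j ⟩
        j + (x + j * pred n)  ≈⟨ +-inverse-mod j x ⟩
        x                     ∎
        where open ≡-mod-Reasoning
      i′+j′≡y : toℕ (opposite i) + j′ ≡ y mod c
      i′+j′≡y = +-cancelˡ-mod (toℕ i + j) (begin
        toℕ i + j + (toℕ (opposite i) + j′)  ≡⟨ toℕ+toℕ-opposite-shifted i j j′ ⟩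
        pred n + (j + j′)                    ≈⟨ x+y≡M ⟨
        x + y                                ≈⟨ +-cong-mod (∣-≡-mod c∣n (≡-mod-sym i+j≡x))
                                                               ≡-mod-refl ⟩
        toℕ i + j + y                        ∎)
        where open ≡-mod-Reasoning

lemma2p21 : (k n : ℕ) .{{_ : NonZero k}} .{{_ : NonZero n}} → 3 ≤ k → 3 ≤ n →
            (a : Tuple k n) → IsHEdge a →
            (c : ℕ) → IsPeriod a c → ¬ (2 ∣ c) →
            NegasymmetricCircuit a c →
            (∃[ s ] (s < n × Negasymmetric (shift a s)))
            × (∃[ b ] (InCircuit a c b × Negasymmetric b
                 × (∀ b' → InCircuit a c b' → Negasymmetric b' → b' ≗ᵗ b)))
lemma2p21 _ _ _ _ _ _ zero (() , _) _ _
lemma2p21 k n _ _ a _ c@(suc _) (_ , c-invariant , c-minimal) 2∤c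
          (b , b′ , (j , _ , b≗) , (j′ , _ , b′≗) , b≗-b′ᴿ)
          with halving-exists 2∤c (j + j′)
... | s , s<c , 2s≡j+j′ =
  (s , <-≤-trans s<c (∣⇒≤ c∣n) , negasymmetric-s) ,
  (shift a s , (s , s<c , λ _ → refl) , negasymmetric-s , unique)
  where
  periodic : Periodic (at a) c
  periodic = shiftInvariant⇒periodic a c-invariant
  minimal : ∀ e → 0 < e → e < c → ¬ Periodic (at a) e
  minimal e 0<e e<c = c-minimal e 0<e e<c ∘ periodic⇒shiftInvariant a
  c∣n : c ∣ n
  c∣n = minimal-period-∣ periodic minimal (at-periodic a)
  skew : SkewSymmetric negₖ c (at a) (pred n + (j + j′))
  skew = reflected-shifts⇒skewSymmetric a c∣n periodic (≗ᵗ-negT-rev-resp b≗ b′≗ b≗-b′ᴿ)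
  skew-s : SkewSymmetric negₖ c (at a) (pred n + (s + s))
  skew-s = skewSymmetric-resp (+-cong-mod (≡-mod-refl {x = pred n}) (≡-mod-sym 2s≡j+j′)) skew
  negasymmetric-s : Negasymmetric (shift a s)
  negasymmetric-s = skewSymmetric⇒negasymmetric-shift a s skew-s
  unique : ∀ b″ → InCircuit a c b″ → Negasymmetric b″ → b″ ≗ᵗ shift a s
  unique b″ (t , t<c , b″≗) negasymmetric-b″ i = trans (b″≗ i) (cong (λ t → shift a t i) t≡s)
    where
    skew-t : SkewSymmetric negₖ c (at a) (pred n + (t + t))
    skew-t = reflected-shifts⇒skewSymmetric a c∣n periodic
               (≗ᵗ-negT-rev-resp b″≗ b″≗ negasymmetric-b″)
    t≡s : t ≡ s
    t≡s = halving-unique 2∤c t<c s<c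
      (+-cancelˡ-mod (pred n) (skewSymmetric-unique periodic minimal skew-t skew-s))
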